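{- Let $\approx$ be an SCER on $\Sigma^*$ and $T$ a string of length $n$. The following algorithm (Algorithm 2), given $\mathit{Border}=\mathit{Border}_T$, runs in $O(n)$ time. Algorithm 2: Set $\mathit{LSChildren}[i]\leftarrow 0$ and $\mathit{LongestLSAnc}[i]\leftarrow i$ for $0\le i\le n$. For $i=1,2,\dots,n$: (a) if $\mathit{LSChildren}[\mathit{Border}[i]]=0$ and $0<2\cdot\mathit{Border}[i]<i$, set $\mathit{LongestLSAnc}[\mathit{Border}[i]]\leftarrow \mathit{LongestLSAnc}[\mathit{LCover}[\mathit{Border}[i]]]$; (b) set $\mathit{LCover}[i]\leftarrow \mathit{LongestLSAnc}[\mathit{Border}[i]]$; (c) set $\mathit{LSChildren}[\mathit{LCover}[i]]\leftarrow \mathit{LSChildren}[\mathit{LCover}[i]]+1$; (d) if $i>1$: let $c_1=i-\mathit{Border}[i]$ and $c_2=(i-1)-\mathit{Border}[i-1]$; for each $j_0$ from $c_2$ to $c_1-1$ in increasing order, set $j\leftarrow j_0$ and, while $\mathit{LSChildren}[j]=0$, set $\mathit{LSChildren}[\mathit{LCover}[j]]\leftarrow\mathit{LSChildren}[\mathit{LCover}[j]]-1$ and then $j\leftarrow \mathit{LCover}[j]$.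
   Context: $\Sigma^*$ is the set of strings over an alphabet $\Sigma$. For a string $T$, $|T|$ is its length, $T[i:j]$ the substring from position $i$ to $j$, $T[:j]=T[1:j]$, $T[i:]=T[i:|T|]$. An SCER is an equivalence relation $\approx$ on $\Sigma^*$ such that $X\approx Y$ implies $|X|=|Y|$ and $X[i:j]\approx Y[i:j]$ for all $1\le i\le j\le|X|$. A string $B$ is a $\approx$-border of $T$ if $B\approx T[:|B|]\approx T[|T|-|B|+1:]$; proper if $|B|<|T|$. The $\approx$-border array $\mathit{Border}_T[1..n]$ has $\mathit{Border}_T[i]$ equal to the maximum length of a proper $\approx$-border of $T[:i]$ (the empty string counts). -}

module Defs where

open import Level using (Level; _⊔_)
open import Data.Nat using (ℕ; zero; suc; _+_; _*_; _∸_; _≤_; _<_; _≡ᵇ_; _<ᵇ_)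
open import Data.Integer as ℤ using (ℤ)
open import Data.Bool using (Bool; true; false; if_then_else_; _∧_)
open import Data.List using (List; length; take; drop)
open import Data.Maybe using (Maybe; just; nothing)
open import Data.Product using (Σ; _×_; _,_; ∃-syntax)
open import Relation.Binary.Core using (Rel)
open import Relation.Binary.Structures using (IsEquivalence)
open import Relation.Binary.PropositionalEquality using (_≡_)

-- T[i:j] for 1 ≤ i ≤ j ≤ |T|
substr : ∀ {a} {A : Set a} → List A → ℕ → ℕ → List A
substr T i j = take (suc j ∸ i) (drop (i ∸ 1) T)

record SCER {a} (A : Set a) (ℓ : Level) : Set (a ⊔ Level.suc ℓ) where
  field
    _≈_      : Rel (List A) ℓ
    isEquiv  : IsEquivalence _≈_
    len      : ∀ {X Y} → X ≈ Y → length X ≡ length Y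
    substrCl : ∀ {X Y} → X ≈ Y → ∀ i j → 1 ≤ i → i ≤ j → j ≤ length X →
               substr X i j ≈ substr Y i j

module _ {a ℓ} {A : Set a} (S : SCER A ℓ) where
  open SCER S

  IsBorder : List A → List A → Set ℓ
  IsBorder B T = (B ≈ take (length B) T) × (take (length B) T ≈ drop (length T ∸ length B) T)

  IsBorderArray : List A → (ℕ → ℕ) → Set (a ⊔ ℓ)
  IsBorderArray T Bd = ∀ i → 1 ≤ i → i ≤ length T →
    (Σ (List A) λ B → IsBorder B (take i T) × length B < i × length B ≡ Bd i)
    × (∀ B → IsBorder B (take i T) → length B < i → length B ≤ Bd i)

-- Algorithm 2 with an explicit step budget (unit-cost RAM model).
-- Arrays are total functions ℕ → _, all entries initialised
-- (LSChildren to 0, LongestLSAnc[i] to i, LCover to 0).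

record St : Set where
  constructor st
  field
    lsc : ℕ → ℤ
    lla : ℕ → ℕ
    lc  : ℕ → ℕ
open St public

upd : ∀ {b} {B : Set b} → (ℕ → B) → ℕ → B → ℕ → B
upd f k v x = if x ≡ᵇ k then v else f x

isZeroℤ : ℤ → Bool
isZeroℤ (ℤ.+ zero) = true
isZeroℤ _ = false

initSt : St
initSt = st (λ _ → ℤ.+ 0) (λ i → i) (λ _ → 0)

whileL : ℕ → St → ℕ → Maybe (St × ℕ)
whileL b s j with isZeroℤ (lsc s j)
... | false = just (s , b)
... | true with b
...   | zero = nothing
...   | suc b' =
  let p = lc s j in
  whileL b' (st (upd (lsc s) p (lsc s p ℤ.- ℤ.+ 1)) (lla s) (lc s)) p

forL : ℕ → ℕ → St → ℕ → Maybe (St × ℕ)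
forL zero j s b = just (s , b)
forL (suc k) j s zero = nothing
forL (suc k) j s (suc b) with whileL b s j
... | nothing = nothing
... | just (s' , b') = forL k (suc j) s' b'

stepI : (ℕ → ℕ) → ℕ → St → ℕ → Maybe (St × ℕ)
stepI Bd i s b =
  let bi = Bd i
      s1 = if isZeroℤ (lsc s bi) ∧ (0 <ᵇ bi) ∧ (2 * bi <ᵇ i)
             then st (lsc s) (upd (lla s) bi (lla s (lc s bi))) (lc s)
             else s
      lc2 = upd (lc s1) i (lla s1 bi)
      p = lc2 i
      s3 = st (upd (lsc s1) p (lsc s1 p ℤ.+ ℤ.+ 1)) (lla s1) lc2
  in if 1 <ᵇ i
       then forL ((i ∸ Bd i) ∸ ((i ∸ 1) ∸ Bd (i ∸ 1))) ((i ∸ 1) ∸ Bd (i ∸ 1)) s3 b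
       else just (s3 , b)

mainL : (ℕ → ℕ) → ℕ → ℕ → St → ℕ → Maybe (St × ℕ)
mainL Bd zero i s b = just (s , b)
mainL Bd (suc k) i s zero = nothing
mainL Bd (suc k) i s (suc b) with stepI Bd i s b
... | nothing = nothing
... | just (s' , b') = mainL Bd k (suc i) s' b'

-- run Algorithm 2 on n and Border with budget b; initialisation costs n+1.
-- Returns nothing iff the budget is exhausted before termination.
algorithm2 : ℕ → (ℕ → ℕ) → ℕ → Maybe (St × ℕ)
algorithm2 n Bd b = if b <ᵇ suc n then nothing else mainL Bd n 1 initSt (b ∸ suc n)

-- Amortised analysis with the potential Φ = Σ_{x ≤ n} max(0, LSChildren[x]). A pass of the
-- while loop in step (d) goes on only if the counter it has just decremented dropped from 1 to 0,
-- so every pass is paid for by Φ + [LSChildren[j] = 0], while step (c) raises Φ by at most one per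
-- iteration. The for loop of iteration i runs c₁ − c₂ = p(i) − p(i−1) times, where p(i) = i − Border[i].
-- Deleting the last symbol of a border of T[:i+1] leaves a border of T[:i] (an SCER is closed under
-- substrings), so Border[i+1] ≤ Border[i] + 1 and p is nondecreasing: the counts telescope to p(n) ≤ n.
module Submission where

open import Defs
open import Level using (Level)
open import Data.Nat using (ℕ; zero; suc; _+_; _*_; _∸_; _≤_; _<_; _≡ᵇ_; _<ᵇ_; z≤n; s≤s; s≤s⁻¹; z<s)
open import Data.Nat.Properties
open import Data.Nat.Solver using (module +-*-Solver)
open import Data.Integer as ℤ using (ℤ)
open import Data.Bool using (Bool; true; false; if_then_else_; T; _∧_)
open import Data.List using (List; length; take; drop)
open import Data.List.Properties using (length-take; take-take; take-drop)
open import Data.Maybe using (Maybe; just; is-just)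
open import Data.Product using (_×_; _,_; proj₁; proj₂; ∃-syntax)
open import Relation.Nullary using (yes; no; contradiction)
open import Relation.Nullary.Reflects using (ofʸ)
open import Relation.Binary.Structures using (IsEquivalence)
open import Relation.Binary.PropositionalEquality

open +-*-Solver using (solve; _:+_; _:*_; con; _:=_)

m+[1+n]≤1+o⇒m+n≤o : ∀ m {n o} → m + suc n ≤ suc o → m + n ≤ o
m+[1+n]≤1+o⇒m+n≤o m {n} {o} h = s≤s⁻¹ (subst (_≤ suc o) (+-suc m n) h)

≤⇒<ᵇ≡false : ∀ {m n} → n ≤ m → (m <ᵇ n) ≡ false
≤⇒<ᵇ≡false {m} {n} n≤m with m <ᵇ n | <ᵇ-reflects-< m n
... | true  | ofʸ m<n = contradiction n≤m (<⇒≱ m<n)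
... | false | _       = refl

if-preserves : ∀ {a p} {A : Set a} (P : A → Set p) c {x y : A} →
               P x → P y → P (if c then x else y)
if-preserves P true  px _  = px
if-preserves P false _  py = py

upd-≡ : ∀ {b} {B : Set b} (f : ℕ → B) k v → upd f k v k ≡ v
upd-≡ f zero    v = refl
upd-≡ f (suc k) v = upd-≡ (λ x → f (suc x)) k v

upd-≢ : ∀ {b} {B : Set b} (f : ℕ → B) {k} v x → x ≢ k → upd f k v x ≡ f x
upd-≢ f {k} v x x≢k with x ≡ᵇ k in eq
... | true  = contradiction (≡ᵇ⇒≡ x k (subst T (sym eq) _)) x≢k
... | false = refl

upd-preserves : ∀ {b p} {B : Set b} (P : B → Set p) (f : ℕ → B) k {v} x →
                P v → P (f x) → P (upd f k v x)
upd-preserves P f k x = if-preserves P (x ≡ᵇ _)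

positivePart : ℤ → ℕ
positivePart (ℤ.+ n)    = n
positivePart ℤ.-[1+ n ] = 0

indicator : Bool → ℕ
indicator true  = 1
indicator false = 0

indicator≤1 : ∀ b → indicator b ≤ 1
indicator≤1 true  = ≤-refl
indicator≤1 false = z≤n

positivePart-pred : ∀ z →
  positivePart (z ℤ.- ℤ.+ 1) + indicator (isZeroℤ (z ℤ.- ℤ.+ 1)) ≤ positivePart z
positivePart-pred (ℤ.+ zero)          = z≤n
positivePart-pred (ℤ.+ suc zero)      = ≤-refl
positivePart-pred (ℤ.+ suc (suc n))   = ≤-trans (≤-reflexive (+-identityʳ (suc n))) (n≤1+n _)
positivePart-pred ℤ.-[1+ n ]          = z≤n

positivePart-suc : ∀ z → positivePart (z ℤ.+ ℤ.+ 1) ≤ suc (positivePart z)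
positivePart-suc (ℤ.+ n)          = ≤-reflexive (+-comm n 1)
positivePart-suc ℤ.-[1+ zero ]    = z≤n
positivePart-suc ℤ.-[1+ suc n ]   = z≤n

potential : (ℕ → ℤ) → ℕ → ℕ
potential f zero    = 0
potential f (suc m) = positivePart (f m) + potential f m

potential-zero : ∀ M → potential (λ _ → ℤ.+ 0) M ≡ 0
potential-zero zero    = refl
potential-zero (suc M) = potential-zero M

potential-upd-outside : ∀ f {p} v M → M ≤ p → potential (upd f p v) M ≡ potential f M
potential-upd-outside f v zero    _   = refl
potential-upd-outside f v (suc m) M≤p =
  cong₂ _+_ (cong positivePart (upd-≢ f v m (<⇒≢ M≤p)))
            (potential-upd-outside f v m (≤-trans (n≤1+n m) M≤p))

potential-upd : ∀ f p v M → p < M →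
  potential (upd f p v) M + positivePart (f p) ≡ potential f M + positivePart v
potential-upd f p v (suc m) p<M with m ≟ p
... | yes refl rewrite upd-≡ f m v | potential-upd-outside f v m ≤-refl =
  solve 3 (λ a b c → (a :+ b) :+ c := (c :+ b) :+ a) refl
    (positivePart v) (potential f m) (positivePart (f m))
... | no m≢p rewrite upd-≢ f v m m≢p = begin
    positivePart (f m) + potential (upd f p v) m + positivePart (f p)
      ≡⟨ +-assoc (positivePart (f m)) _ _ ⟩
    positivePart (f m) + (potential (upd f p v) m + positivePart (f p))
      ≡⟨ cong (positivePart (f m) +_) (potential-upd f p v m p<m) ⟩
    positivePart (f m) + (potential f m + positivePart v)
      ≡⟨ +-assoc (positivePart (f m)) _ _ ⟨
    positivePart (f m) + potential f m + positivePart v ∎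
  where
    open ≡-Reasoning
    p<m : p < m
    p<m = ≤∧≢⇒< (s≤s⁻¹ p<M) (≢-sym m≢p)

potential-decrement : ∀ f p M → p < M →
  let f′ = upd f p (f p ℤ.- ℤ.+ 1) in
  potential f′ M + indicator (isZeroℤ (f′ p)) ≤ potential f M
potential-decrement f p M p<M rewrite upd-≡ f p (f p ℤ.- ℤ.+ 1) =
  +-cancelʳ-≤ (positivePart (f p)) _ _ (begin
    Φ′ + χ + positivePart (f p)          ≡⟨ +-assoc Φ′ χ _ ⟩
    Φ′ + (χ + positivePart (f p))        ≡⟨ cong (Φ′ +_) (+-comm χ _) ⟩
    Φ′ + (positivePart (f p) + χ)        ≡⟨ +-assoc Φ′ _ χ ⟨
    Φ′ + positivePart (f p) + χ          ≡⟨ cong (_+ χ) (potential-upd f p v M p<M) ⟩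
    potential f M + positivePart v + χ   ≡⟨ +-assoc (potential f M) _ χ ⟩
    potential f M + (positivePart v + χ) ≤⟨ +-monoʳ-≤ (potential f M) (positivePart-pred (f p)) ⟩
    potential f M + positivePart (f p)   ∎)
  where
    open ≤-Reasoning
    v : ℤ
    v = f p ℤ.- ℤ.+ 1
    Φ′ χ : ℕ
    Φ′ = potential (upd f p v) M
    χ = indicator (isZeroℤ v)

potential-increment : ∀ f p M → p < M →
  potential (upd f p (f p ℤ.+ ℤ.+ 1)) M ≤ suc (potential f M)
potential-increment f p M p<M = +-cancelʳ-≤ (positivePart (f p)) _ _ (begin
    potential (upd f p v) M + positivePart (f p) ≡⟨ potential-upd f p v M p<M ⟩
    potential f M + positivePart v               ≤⟨ +-monoʳ-≤ (potential f M) (positivePart-suc (f p)) ⟩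
    potential f M + suc (positivePart (f p))     ≡⟨ +-suc (potential f M) _ ⟩
    suc (potential f M) + positivePart (f p)     ∎)
  where
    open ≤-Reasoning
    v : ℤ
    v = f p ℤ.+ ℤ.+ 1

-- Every counter the algorithm increments or decrements lies below M, so it is seen by the potential.
Bounded : ℕ → St → Set
Bounded M s = (∀ x → lc s x < M) × (∀ x → x < M → lla s x < M)

record Succeeds (M e : ℕ) (run : Maybe (St × ℕ)) : Set where
  constructor succeeds
  field
    {final}  : St
    {left}   : ℕ
    runs     : run ≡ just (final , left)
    bounded  : Bounded M final
    covers   : potential (lsc final) M + e ≤ left

module _ {M : ℕ} where

  whileL-succeeds : ∀ b s j e → Bounded M s →
    potential (lsc s) M + (indicator (isZeroℤ (lsc s j)) + e) ≤ b → Succeeds M e (whileL b s j)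
  whileL-succeeds b s j e bnd h with isZeroℤ (lsc s j)
  ... | false = succeeds refl bnd h
  ... | true with b
  ...   | zero  = contradiction (m+n≤o⇒n≤o (potential (lsc s) M) h) λ ()
  ...   | suc b = whileL-succeeds b _ p e bnd (begin
      Φ′ + (χ′ + e)           ≡⟨ +-assoc Φ′ χ′ e ⟨
      Φ′ + χ′ + e             ≤⟨ +-monoˡ-≤ e (potential-decrement (lsc s) p M (proj₁ bnd j)) ⟩
      potential (lsc s) M + e ≤⟨ m+[1+n]≤1+o⇒m+n≤o (potential (lsc s) M) h ⟩
      b                       ∎)
    where
      open ≤-Reasoning
      p : ℕ
      p = lc s j
      f′ : ℕ → ℤ
      f′ = upd (lsc s) p (lsc s p ℤ.- ℤ.+ 1)
      Φ′ χ′ : ℕ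
      Φ′ = potential f′ M
      χ′ = indicator (isZeroℤ (f′ p))

  forL-succeeds : ∀ k j s b e → Bounded M s →
    potential (lsc s) M + (2 * k + e) ≤ b → Succeeds M e (forL k j s b)
  forL-succeeds zero    j s b       e bnd h = succeeds refl bnd h
  forL-succeeds (suc k) j s zero    e bnd h = contradiction (m+n≤o⇒n≤o (potential (lsc s) M) h) λ ()
  forL-succeeds (suc k) j s (suc b) e bnd h
    with whileL-succeeds b s j (2 * k + e) bnd (≤-trans
           (+-monoʳ-≤ (potential (lsc s) M) (+-monoˡ-≤ (2 * k + e) (indicator≤1 (isZeroℤ (lsc s j)))))
           (m+[1+n]≤1+o⇒m+n≤o (potential (lsc s) M)
             (subst (λ c → potential (lsc s) M + (c + e) ≤ suc b) (*-suc 2 k) h)))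
  ... | succeeds runs bnd′ covers rewrite runs = forL-succeeds k (suc j) _ _ e bnd′ covers

linkCondition : (ℕ → ℕ) → ℕ → St → Bool
linkCondition Bd i s = isZeroℤ (lsc s (Bd i)) ∧ (0 <ᵇ Bd i) ∧ (2 * Bd i <ᵇ i)

linkStep : (ℕ → ℕ) → ℕ → St → St
linkStep Bd i s = if linkCondition Bd i s
  then st (lsc s) (upd (lla s) (Bd i) (lla s (lc s (Bd i)))) (lc s)
  else s

assignCover : (ℕ → ℕ) → ℕ → St → St
assignCover Bd i s = st (upd (lsc s₁) p (lsc s₁ p ℤ.+ ℤ.+ 1)) (lla s₁) cover
  where
    s₁ : St
    s₁ = linkStep Bd i s
    cover : ℕ → ℕ
    cover = upd (lc s₁) i (lla s₁ (Bd i))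
    p : ℕ
    p = cover i

period : (ℕ → ℕ) → ℕ → ℕ
period Bd i = i ∸ Bd i

periodGrowth : (ℕ → ℕ) → ℕ → ℕ
periodGrowth Bd j = period Bd (suc j) ∸ period Bd j

module _ {M : ℕ} (Bd : ℕ → ℕ) where

  linkStep-lsc : ∀ i s → lsc (linkStep Bd i s) ≡ lsc s
  linkStep-lsc i s = if-preserves (λ t → lsc t ≡ lsc s) (linkCondition Bd i s) refl refl

  linkStep-bounded : ∀ i s → Bounded M s → Bounded M (linkStep Bd i s)
  linkStep-bounded i s bnd@(lc< , lla<) = if-preserves (Bounded M) (linkCondition Bd i s)
    (lc< , λ y y<M → upd-preserves (_< M) (lla s) (Bd i) y (lla< _ (lc< (Bd i))) (lla< y y<M)) bnd

  assignCover-bounded : ∀ i s → Bd i < M → Bounded M s → Bounded M (assignCover Bd i s)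
  assignCover-bounded i s Bd<M bnd =
    (λ x → upd-preserves (_< M) (lc s₁) i x (lla<₁ (Bd i) Bd<M) (lc<₁ x)) , lla<₁
    where
      s₁ : St
      s₁ = linkStep Bd i s
      lc<₁ : ∀ x → lc s₁ x < M
      lc<₁ = proj₁ (linkStep-bounded i s bnd)
      lla<₁ : ∀ x → x < M → lla s₁ x < M
      lla<₁ = proj₂ (linkStep-bounded i s bnd)

  assignCover-potential : ∀ i s → Bd i < M → Bounded M s →
    potential (lsc (assignCover Bd i s)) M ≤ suc (potential (lsc s) M)
  assignCover-potential i s Bd<M bnd =
    subst (λ f → potential (lsc (assignCover Bd i s)) M ≤ suc (potential f M)) (linkStep-lsc i s)
      (potential-increment (lsc (linkStep Bd i s)) _ M (proj₁ (assignCover-bounded i s Bd<M bnd) i))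

  assignCover-covers : ∀ i s c b → Bd i < M → Bounded M s →
    potential (lsc s) M + suc c ≤ b → potential (lsc (assignCover Bd i s)) M + c ≤ b
  assignCover-covers i s c b Bd<M bnd h =
    ≤-trans (+-monoˡ-≤ c (assignCover-potential i s Bd<M bnd))
            (subst (_≤ b) (+-suc (potential (lsc s) M) c) h)

  stepI-succeeds : ∀ j s b e → Bd (suc j) < M → Bounded M s →
    potential (lsc s) M + (suc (2 * periodGrowth Bd j) + e) ≤ b → Succeeds M e (stepI Bd (suc j) s b)
  stepI-succeeds zero s b e Bd<M bnd h =
    succeeds refl (assignCover-bounded 1 s Bd<M bnd)
      (assignCover-covers 1 s e b Bd<M bnd (≤-trans (+-monoʳ-≤ _ (s≤s (m≤n+m e _))) h))
  stepI-succeeds (suc j) s b e Bd<M bnd h =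
    forL-succeeds (periodGrowth Bd (suc j)) (period Bd (suc j)) _ b e
      (assignCover-bounded (suc (suc j)) s Bd<M bnd) (assignCover-covers (suc (suc j)) s _ b Bd<M bnd h)

-- Per iteration: 1 for the main loop, 1 for the increment of step (c), 2 per pass of the for loop.
mainCost : (ℕ → ℕ) → ℕ → ℕ → ℕ
mainCost Bd j zero    = 0
mainCost Bd j (suc k) = 2 + 2 * periodGrowth Bd j + mainCost Bd (suc j) k

module _ (Bd : ℕ → ℕ) (n : ℕ) where

  mainL-succeeds : ∀ {M} → (∀ j → j < n → Bd (suc j) < M) →
    ∀ k j s b e → j + k ≤ n → Bounded M s →
    potential (lsc s) M + (mainCost Bd j k + e) ≤ b → Succeeds M e (mainL Bd k (suc j) s b)
  mainL-succeeds Bd< zero    j s b       e _ bnd h = succeeds refl bnd h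
  mainL-succeeds {M} Bd< (suc k) j s zero e _ bnd h = contradiction (m+n≤o⇒n≤o (potential (lsc s) M) h) λ ()
  mainL-succeeds {M} Bd< (suc k) j s (suc b) e j+k≤n bnd h
    with stepI-succeeds Bd j s b (mainCost Bd (suc j) k + e) (Bd< j (<-≤-trans (m<m+n j z<s) j+k≤n)) bnd
           (subst (λ c → potential (lsc s) M + suc c ≤ b) (+-assoc (2 * periodGrowth Bd j) _ e)
             (m+[1+n]≤1+o⇒m+n≤o (potential (lsc s) M) h))
  ... | succeeds runs bnd′ covers rewrite runs =
    mainL-succeeds Bd< k (suc j) _ _ e (subst (_≤ n) (+-suc j k) j+k≤n) bnd′ covers

  mainCost-telescopes : (∀ t → t < n → period Bd t ≤ period Bd (suc t)) →
    ∀ j k → j + k ≤ n → mainCost Bd j k + 2 * period Bd j ≡ 2 * k + 2 * period Bd (j + k)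
  mainCost-telescopes mono j zero    _     = cong (λ t → 2 * period Bd t) (sym (+-identityʳ j))
  mainCost-telescopes mono j (suc k) j+k≤n = begin
    2 + 2 * g + rest + 2 * period Bd j
      ≡⟨ solve 4 (λ g r p o → con 2 :+ con 2 :* g :+ r :+ con 2 :* p := con 2 :+ (r :+ con 2 :* (g :+ p)))
           refl g rest (period Bd j) 0 ⟩
    2 + (rest + 2 * (g + period Bd j))
      ≡⟨ cong (λ p → 2 + (rest + 2 * p)) (m∸n+n≡m (mono j (<-≤-trans (m<m+n j z<s) j+k≤n))) ⟩
    2 + (rest + 2 * period Bd (suc j))
      ≡⟨ cong (2 +_) (mainCost-telescopes mono (suc j) k (subst (_≤ n) (+-suc j k) j+k≤n)) ⟩
    2 + (2 * k + 2 * period Bd (suc j + k))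
      ≡⟨ cong₂ _+_ (sym (*-suc 2 k)) (cong (λ t → 2 * period Bd t) (sym (+-suc j k))) ⟩
    2 * suc k + 2 * period Bd (j + suc k) ∎
    where
      open ≡-Reasoning
      g rest : ℕ
      g = periodGrowth Bd j
      rest = mainCost Bd (suc j) k

algorithm2-runs-mainL : ∀ n Bd b → suc n ≤ b → algorithm2 n Bd b ≡ mainL Bd n 1 initSt (b ∸ suc n)
algorithm2-runs-mainL n Bd b n<b rewrite ≤⇒<ᵇ≡false n<b = refl

algorithm2-succeeds : ∀ n Bd → (∀ j → j < n → Bd (suc j) ≤ j) →
  (∀ t → t < n → period Bd t ≤ period Bd (suc t)) → is-just (algorithm2 n Bd (5 * (n + 1))) ≡ true
algorithm2-succeeds n Bd proper mono =
  cong is-just (trans (algorithm2-runs-mainL n Bd _ n<budget) (Succeeds.runs run))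
  where
    open ≤-Reasoning
    n<budget : suc n ≤ 5 * (n + 1)
    n<budget = ≤-trans (≤-reflexive (+-comm 1 n)) (m≤n*m (n + 1) 5)
    enough : potential (lsc initSt) (suc n) + (mainCost Bd 0 n + 0) ≤ 5 * (n + 1) ∸ suc n
    enough = begin
      potential (lsc initSt) (suc n) + (mainCost Bd 0 n + 0)
        ≡⟨ cong₂ _+_ (potential-zero (suc n)) (+-identityʳ _) ⟩
      mainCost Bd 0 n                   ≤⟨ m≤m+n _ _ ⟩
      mainCost Bd 0 n + 2 * period Bd 0 ≡⟨ mainCost-telescopes Bd n mono 0 n ≤-refl ⟩
      2 * n + 2 * period Bd n           ≤⟨ +-monoʳ-≤ (2 * n) (*-monoʳ-≤ 2 (m∸n≤m n (Bd n))) ⟩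
      2 * n + 2 * n                     ≤⟨ m+n≤o⇒m≤o∸n (2 * n + 2 * n) (≤-trans (m≤m+n _ 4) (≤-reflexive
                                             (solve 1 (λ n → con 2 :* n :+ con 2 :* n :+ (con 1 :+ n) :+ con 4
                                                           := con 5 :* (n :+ con 1)) refl n))) ⟩
      5 * (n + 1) ∸ suc n               ∎
    run : Succeeds (suc n) 0 (mainL Bd n 1 initSt (5 * (n + 1) ∸ suc n))
    run = mainL-succeeds Bd n (λ j j<n → s≤s (≤-trans (proper j j<n) (<⇒≤ j<n))) n 0 initSt _ 0 ≤-refl
            ((λ _ → z<s) , λ _ x<M → x<M) enough

take-take-≤ : ∀ {a} {A : Set a} {m n} (xs : List A) → m ≤ n → take m (take n xs) ≡ take m xs
take-take-≤ {m = m} {n} xs m≤n = trans (take-take m n xs) (cong (λ k → take k xs) (m≤n⇒m⊓n≡m m≤n))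

length-take-≤ : ∀ {a} {A : Set a} {m} (xs : List A) → m ≤ length xs → length (take m xs) ≡ m
length-take-≤ {m = m} xs m≤ = trans (length-take m xs) (m≤n⇒m⊓n≡m m≤)

module _ {a ℓ} {A : Set a} (S : SCER A ℓ) where
  open SCER S
  open IsEquivalence isEquiv using () renaming (refl to ≈-refl)

  ≈-take : ∀ {X Y} m → X ≈ Y → m ≤ length X → take m X ≈ take m Y
  ≈-take zero    _   _  = ≈-refl
  ≈-take (suc m) X≈Y m≤ = substrCl X≈Y 1 (suc m) (s≤s z≤n) (s≤s z≤n) m≤

  border-init : ∀ {B} T {i m} → suc i ≤ length T → m ≤ i → length B ≡ suc m →
    IsBorder S B (take (suc i) T) → IsBorder S (take m B) (take i T)
  border-init {B} T {i} {m} i<|T| m≤i |B|≡ (B≈ , ≈suffix)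
    rewrite length-take-≤ B (subst (m ≤_) (sym |B|≡) (n≤1+n m))
          | length-take-≤ T (<⇒≤ i<|T|) =
    subst (take m B ≈_) prefix (≈-take m B≈ m≤|B|) ,
    subst₂ _≈_ prefix suffix (≈-take m ≈suffix (≤-trans (n≤1+n m) (≤-reflexive (sym |W[:|B|]|))))
    where
      open ≡-Reasoning
      W : List A
      W = take (suc i) T
      d : ℕ
      d = i ∸ m
      |W| : length W ≡ suc i
      |W| = length-take-≤ T i<|T|
      m≤|B| : m ≤ length B
      m≤|B| = subst (m ≤_) (sym |B|≡) (n≤1+n m)
      |W[:|B|]| : length (take (length B) W) ≡ suc m
      |W[:|B|]| = trans (length-take-≤ W (subst₂ _≤_ (sym |B|≡) (sym |W|) (s≤s m≤i))) |B|≡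
      prefix : take m (take (length B) W) ≡ take m (take i T)
      prefix = begin
        take m (take (length B) W) ≡⟨ cong (λ k → take m (take k W)) |B|≡ ⟩
        take m (take (suc m) W)    ≡⟨ take-take-≤ W (n≤1+n m) ⟩
        take m W                   ≡⟨ take-take-≤ T (≤-trans m≤i (n≤1+n i)) ⟩
        take m T                   ≡⟨ take-take-≤ T m≤i ⟨
        take m (take i T)          ∎
      suffix : take m (drop (length W ∸ length B) W) ≡ drop d (take i T)
      suffix = begin
        take m (drop (length W ∸ length B) W) ≡⟨ cong (λ k → take m (drop k W)) (cong₂ _∸_ |W| |B|≡) ⟩
        take m (drop d W)                     ≡⟨ take-drop m d W ⟩
        drop d (take (d + m) W)               ≡⟨ cong (λ k → drop d (take k W)) (m∸n+n≡m m≤i) ⟩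
        drop d (take i W)                     ≡⟨ cong (drop d) (take-take-≤ T (n≤1+n i)) ⟩
        drop d (take i T)                     ∎

  module _ {T : List A} {Bd : ℕ → ℕ} (isBorderArray : IsBorderArray S T Bd) where

    border-proper : ∀ j → j < length T → Bd (suc j) ≤ j
    border-proper j j<n with proj₁ (isBorderArray (suc j) (s≤s z≤n) j<n)
    ... | _ , _ , |B|< , |B|≡ = s≤s⁻¹ (subst (_< suc j) |B|≡ |B|<)

    border-suc : ∀ i → suc i < length T → Bd (suc (suc i)) ≤ suc (Bd (suc i))
    border-suc i i<n with proj₁ (isBorderArray (suc (suc i)) (s≤s z≤n) i<n)
    ... | B , border , |B|< , |B|≡ = subst (_≤ suc (Bd (suc i))) |B|≡ (shorten (length B) refl)
      where
        shorten : ∀ L → length B ≡ L → L ≤ suc (Bd (suc i))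
        shorten zero    _      = z≤n
        shorten (suc m) |B|≡L = s≤s (subst (_≤ Bd (suc i)) |B[:m]|
          (proj₂ (isBorderArray (suc i) (s≤s z≤n) (<⇒≤ i<n)) (take m B)
            (border-init T i<n (<⇒≤ m<1+i) |B|≡L border) (subst (_< suc i) (sym |B[:m]|) m<1+i)))
          where
            m<1+i : m < suc i
            m<1+i = s≤s⁻¹ (subst (_< suc (suc i)) |B|≡L |B|<)
            |B[:m]| : length (take m B) ≡ m
            |B[:m]| = length-take-≤ B (subst (m ≤_) (sym |B|≡L) (n≤1+n m))

    period-mono : ∀ t → t < length T → period Bd t ≤ period Bd (suc t)
    period-mono zero    _   = subst (_≤ period Bd 1) (sym (0∸n≡0 (Bd 0))) z≤n
    period-mono (suc i) i<n = ∸-monoʳ-≤ (suc (suc i)) (border-suc i i<n)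

lemma18 : ∀ {a ℓ : Level} → ∃[ C ] (∀ {A : Set a} (S : SCER A ℓ) (T : List A) (Bd : ℕ → ℕ) →
            IsBorderArray S T Bd → is-just (algorithm2 (length T) Bd (C * (length T + 1))) ≡ true)
lemma18 = 5 , λ S T Bd isBorderArray →
  algorithm2-succeeds (length T) Bd (border-proper S isBorderArray) (period-mono S isBorderArray)
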